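{- Consider Girard's system F over the base types $e_1,\dots,e_n,t$, together with constants $c_{ij}:e_i\to e_j$ for a given set of base coercions, and the term-annotated coercive subtyping system whose judgements have the form $x:A<s:B$, whose axioms are $x:e_i<c_{ij}(x):e_j$ for each base coercion constant, and whose rules are: (transitivity) from $x:A<t:B$ and $y:B<u:C$ derive $x:A<u[y:=t]:C$; (arrow, both sides) from $x:A<t:B$ and $z:C<u:D$ derive $f:D\to A<\lambda z^C.\,t[x:=f(u)]:C\to B$; (arrow, covariant) from $x:A<t:B$ derive $f:T\to A<\lambda w^T.\,t[x:=f(w)]:T\to B$; (arrow, contravariant) from $x:A<t:B$ derive $g:B\to T<\lambda x^A.\,g(t):A\to T$; (type-quantifier introduction) from $u:U<t:T[X]$ derive $u:U<\Lambda X.\,t:\Pi X.\,T[X]$, provided $X$ is not free in $U$; (type-quantifier elimination) from $u:U<t:\Pi X.\,T[X]$ derive $u:U<t\{W\}:T[W]$. Then not every $\Lambda$-term of system F arises as a term derived in this subtyping system.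
   Context: System F types: base types $e_1,\dots,e_n$ and $t$, type variables, $\Pi\alpha.\,T$, and $T_1\to T_2$; terms built from variables, constants, application, $\lambda$-abstraction, type application $\tau\{U\}$ and type abstraction $\Lambda\alpha.\,\tau$. The base coercions $c_{ij}:e_i\to e_j$ form a transitive and acyclic relation on base types, with at most one coercion between any two base types, and satisfy $c_{jk}\circ c_{ij}=c_{ik}$. -}

module Defs where

open import Data.Nat using (ℕ; zero; suc)
open import Data.Fin using (Fin; zero; suc)
open import Data.Bool using (Bool; T)
open import Data.Vec using (Vec; []; _∷_; lookup; map)
open import Relation.Nullary using (¬_)

-- System F types over base types e_1..e_n (base i) and t (tB).
-- Type variables are de Bruijn indices; Ty n k = types with k free
-- type variables.

data Ty (n : ℕ) (k : ℕ) : Set where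
  base : Fin n → Ty n k
  tB   : Ty n k
  tvar : Fin k → Ty n k
  Π    : Ty n (suc k) → Ty n k
  _⇒_  : Ty n k → Ty n k → Ty n k

infixr 7 _⇒_

extR : ∀ {k k'} → (Fin k → Fin k') → Fin (suc k) → Fin (suc k')
extR ρ zero    = zero
extR ρ (suc i) = suc (ρ i)

renT : ∀ {n k k'} → (Fin k → Fin k') → Ty n k → Ty n k'
renT ρ (base i) = base i
renT ρ tB       = tB
renT ρ (tvar i) = tvar (ρ i)
renT ρ (Π A)    = Π (renT (extR ρ) A)
renT ρ (A ⇒ B)  = renT ρ A ⇒ renT ρ B

extsT : ∀ {n k k'} → (Fin k → Ty n k') → Fin (suc k) → Ty n (suc k')
extsT σ zero    = tvar zero
extsT σ (suc i) = renT suc (σ i)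

subT : ∀ {n k k'} → (Fin k → Ty n k') → Ty n k → Ty n k'
subT σ (base i) = base i
subT σ tB       = tB
subT σ (tvar i) = σ i
subT σ (Π A)    = Π (subT (extsT σ) A)
subT σ (A ⇒ B)  = subT σ A ⇒ subT σ B

single : ∀ {n k} → Ty n k → Fin (suc k) → Ty n k
single W zero    = W
single W (suc i) = tvar i

_[_]T : ∀ {n k} → Ty n (suc k) → Ty n k → Ty n k
A [ W ]T = subT (single W) A

-- Base coercions: a Boolean relation C on Fin n (C i j = true iff the
-- constant c_ij exists; hence at most one coercion between two types).

record CoercionHyps {n : ℕ} (C : Fin n → Fin n → Bool) : Set where
  field
    trans   : ∀ {i j l} → T (C i j) → T (C j l) → T (C i l)
    acyclic : ∀ {i} → ¬ T (C i i)

-- System F terms (Church style), with constants c_ij.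
-- Tm C k m : k free type variables, m free term variables (de Bruijn).

data Tm {n : ℕ} (C : Fin n → Fin n → Bool) (k : ℕ) : ℕ → Set where
  var  : ∀ {m} → Fin m → Tm C k m
  con  : ∀ {m} (i j : Fin n) → T (C i j) → Tm C k m
  app  : ∀ {m} → Tm C k m → Tm C k m → Tm C k m
  lam  : ∀ {m} → Ty n k → Tm C k (suc m) → Tm C k m
  tapp : ∀ {m} → Tm C k m → Ty n k → Tm C k m
  tlam : ∀ {m} → Tm C (suc k) m → Tm C k m

module _ {n : ℕ} {C : Fin n → Fin n → Bool} where

  tyRen : ∀ {k k' m} → (Fin k → Fin k') → Tm C k m → Tm C k' m
  tyRen ρ (var x)      = var x
  tyRen ρ (con i j p)  = con i j p
  tyRen ρ (app s t)    = app (tyRen ρ s) (tyRen ρ t)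
  tyRen ρ (lam A t)    = lam (renT ρ A) (tyRen ρ t)
  tyRen ρ (tapp t U)   = tapp (tyRen ρ t) (renT ρ U)
  tyRen ρ (tlam t)     = tlam (tyRen (extR ρ) t)

  ren : ∀ {k m m'} → (Fin m → Fin m') → Tm C k m → Tm C k m'
  ren ρ (var x)     = var (ρ x)
  ren ρ (con i j p) = con i j p
  ren ρ (app s t)   = app (ren ρ s) (ren ρ t)
  ren ρ (lam A t)   = lam A (ren (extR ρ) t)
  ren ρ (tapp t U)  = tapp (ren ρ t) U
  ren ρ (tlam t)    = tlam (ren ρ t)

  exts : ∀ {k m m'} → (Fin m → Tm C k m') → Fin (suc m) → Tm C k (suc m')
  exts σ zero    = var zero
  exts σ (suc i) = ren suc (σ i)

  sub : ∀ {k m m'} → (Fin m → Tm C k m') → Tm C k m → Tm C k m'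
  sub σ (var x)     = σ x
  sub σ (con i j p) = con i j p
  sub σ (app s t)   = app (sub σ s) (sub σ t)
  sub σ (lam A t)   = lam A (sub (exts σ) t)
  sub σ (tapp t U)  = tapp (sub σ t) U
  sub σ (tlam t)    = tlam (sub (λ x → tyRen suc (σ x)) t)

  data _⊢_∶_ {k m : ℕ} (Γ : Vec (Ty n k) m) : Tm C k m → Ty n k → Set where
    ⊢var  : ∀ x → Γ ⊢ var x ∶ lookup Γ x
    ⊢con  : ∀ i j (p : T (C i j)) → Γ ⊢ con i j p ∶ (base i ⇒ base j)
    ⊢app  : ∀ {s t A B} → Γ ⊢ s ∶ (A ⇒ B) → Γ ⊢ t ∶ A → Γ ⊢ app s t ∶ B
    ⊢lam  : ∀ {A B t} → (A ∷ Γ) ⊢ t ∶ B → Γ ⊢ lam A t ∶ (A ⇒ B)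
    ⊢tapp : ∀ {t A} W → Γ ⊢ t ∶ Π A → Γ ⊢ tapp t W ∶ (A [ W ]T)
    ⊢tlam : ∀ {t A} → map (renT suc) Γ ⊢ t ∶ A → Γ ⊢ tlam t ∶ Π A

  -- Term-annotated coercive subtyping  x:A < s:B.
  -- s : Tm C k 1, its unique free term variable (index 0) is x.

  data _<_∶_ {k : ℕ} : Ty n k → Tm C k 1 → Ty n k → Set where
    ax    : ∀ i j (p : T (C i j)) →
            base i < app (con i j p) (var zero) ∶ base j
    trans : ∀ {A B D t u} → A < t ∶ B → B < u ∶ D →
            A < sub (λ _ → t) u ∶ D
    -- from x:A<t:B, z:C'<u:D derive f:D→A < λz^C'. t[x:=f(u)] : C'→B
    -- (in the body: var 0 = z, var 1 = f)
    arr   : ∀ {A B C' D t u} → A < t ∶ B → C' < u ∶ D →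
            (D ⇒ A) < lam C' (sub (λ _ → app (var (suc zero)) (ren (λ _ → zero) u)) t) ∶ (C' ⇒ B)
    arrCo : ∀ {A B t} (T' : Ty n k) → A < t ∶ B →
            (T' ⇒ A) < lam T' (sub (λ _ → app (var (suc zero)) (var zero)) t) ∶ (T' ⇒ B)
    -- from x:A<t:B derive g:B→T' < λx^A. g(t) : A→T'
    -- (in the body: var 0 = x, var 1 = g)
    arrCt : ∀ {A B t} (T' : Ty n k) → A < t ∶ B →
            (B ⇒ T') < lam A (app (var (suc zero)) (ren (λ _ → zero) t)) ∶ (A ⇒ T')
    -- from u:U<t:T[X] derive u:U < ΛX.t : ΠX.T[X], X not free in U
    -- (X not free in U: the premise's U is the weakening of a U in context k)
    Πintro : ∀ {U A t} → renT suc U < t ∶ A → U < tlam t ∶ Π A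
    Πelim  : ∀ {U A t} (W : Ty n k) → U < t ∶ Π A → U < tapp t W ∶ (A [ W ]T)

-- The subtyping system has no reflexivity rule: an axiom yields an
-- application c_ij(x), every other rule except transitivity builds a
-- λ-, Λ- or type application, and transitivity substitutes into the
-- term of its second premise, which by induction is not a variable.
-- So no derived term is a bare variable, while x : t ⊢ x : t is typable.
module Submission where

open import Defs
open import Data.Nat using (ℕ)
open import Data.Fin using (Fin; zero)
open import Data.Bool using (Bool)
open import Data.Vec using (_∷_; [])
open import Data.Product using (Σ; _×_; _,_)
open import Data.Empty using (⊥)
open import Data.Unit using (⊤; tt)
open import Relation.Nullary using (¬_)

module _ {n : ℕ} {C : Fin n → Fin n → Bool} where

  NonVariable : ∀ {k m} → Tm C k m → Set
  NonVariable (var _) = ⊥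
  NonVariable _       = ⊤

  sub-nonVariable : ∀ {k m m'} (σ : Fin m → Tm C k m') (u : Tm C k m) →
                    NonVariable u → NonVariable (sub σ u)
  sub-nonVariable σ (var x)     ()
  sub-nonVariable σ (con i j p) _ = tt
  sub-nonVariable σ (app s t)   _ = tt
  sub-nonVariable σ (lam A t)   _ = tt
  sub-nonVariable σ (tapp t U)  _ = tt
  sub-nonVariable σ (tlam t)    _ = tt

  <⇒nonVariable : ∀ {k} {A B : Ty n k} {t : Tm C k 1} → A < t ∶ B → NonVariable t
  <⇒nonVariable (ax i j p)                  = tt
  <⇒nonVariable (trans {t = t} {u = u} _ e) = sub-nonVariable (λ _ → t) u (<⇒nonVariable e)
  <⇒nonVariable (arr _ _)                   = tt
  <⇒nonVariable (arrCo _ _)                 = tt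
  <⇒nonVariable (arrCt _ _)                 = tt
  <⇒nonVariable (Πintro _)                  = tt
  <⇒nonVariable (Πelim _ _)                 = tt

mainTheorem2 : (n : ℕ) (C : Fin n → Fin n → Bool) → CoercionHyps C →
    Σ ℕ λ k → Σ (Ty n k) λ A → Σ (Ty n k) λ B → Σ (Tm C k 1) λ τ →
      ((A ∷ []) ⊢ τ ∶ B) × ((A' B' : Ty n k) → ¬ (A' < τ ∶ B'))
mainTheorem2 n C _ = 0 , tB , tB , var zero , ⊢var zero , λ _ _ → <⇒nonVariable
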